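{- Let $n\ge 2$, let $K_n=(V,E)$ be the complete graph on the vertex set $V$ with $|V|=n$, and let $X,Y$ be two distinct cuts of $K_n$. Then the cones $K^{+}_{\min}(X)$ and $K^{+}_{\min}(Y)$ are adjacent (i.e. $\dim\big(K^{+}_{\min}(X)\cap K^{+}_{\min}(Y)\big)=d-1$, where $d=\binom{n}{2}$) if and only if $X$ and $Y$ are not crossing.
   Context: Let $d=\binom{n}{2}=|E|$. For $S\subseteq V$, the cut vector $\mathbf{v}(S)\in\{0,1\}^{d}$ has coordinates indexed by edges $\{i,j\}\in E$, with $\mathbf{v}(S)_{i,j}=1$ if $|S\cap\{i,j\}|=1$ and $0$ otherwise. A cut is a nonempty proper subset $X\subset V$, where $X$ and its complement $\bar X=V\setminus X$ are identified (they have the same cut vector); the empty cut is excluded, so there are $2^{n-1}-1$ cuts. For a cut $X$, define the convex polyhedral cone $K^{+}_{\min}(X)=\{\mathbf{c}\in\mathbb{R}^{d}:\ \mathbf{c}\ge\mathbf{0},\ \langle\mathbf{c},\mathbf{v}(X)\rangle\le\langle\mathbf{c},\mathbf{v}(Y)\rangle \text{ for all cuts } Y\}$. These cones form the cone partition of the nonnegative orthant for the min-cut problem with non-negative edge weights. Two such cones $K^{+}_{\min}(X),K^{+}_{\min}(Y)$ ($X\ne Y$) are called adjacent if $\dim\big(K^{+}_{\min}(X)\cap K^{+}_{\min}(Y)\big)=d-1$. Two subsets $A,B\subset V$ are crossing if $A\cap B\neq\emptyset$, $A\setminus B\ne\emptyset$, $B\setminus A\neq\emptyset$ and $V\setminus(A\cup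 B)\neq\emptyset$ (this property is invariant under replacing $A$ or $B$ by its complement).
   Formalization: The cones $K^{+}_{\min}(X)$ are taken in ℚ^d in place of ℝ^d, and the dimension of their intersection is the largest number of ℚ-linearly independent rational points in it. -}

module Defs where

open import Data.Bool using (Bool; true; false; if_then_else_; _xor_)
open import Data.Nat as ℕ using (ℕ)
open import Data.Nat.Combinatorics using (_C_)
open import Data.Fin as Fin using (Fin; _<_; _<?_)
open import Data.Fin.Subset using (Subset; ∁; _∩_; _∪_; Nonempty)
open import Data.Vec using (lookup)
open import Data.List using (List; foldr; allFin)
open import Data.Product using (Σ; Σ-syntax; _×_; _,_; proj₁; proj₂; ∃-syntax)
open import Data.Rational using (ℚ; 0ℚ; 1ℚ; _+_; _*_; _≤_)
open import Relation.Nullary using (¬_; yes; no)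
open import Relation.Binary.PropositionalEquality using (_≡_; _≢_)

-- The complete graph K_n on V = Fin n.  Edges {i,j} are represented
-- uniquely as ordered pairs (i , j) with i < j.

Edge : ℕ → Set
Edge n = Σ[ p ∈ Fin n × Fin n ] (proj₁ p < proj₂ p)

dim-ambient : ℕ → ℕ
dim-ambient n = n C 2

Vector : ℕ → Set
Vector n = Edge n → ℚ

sumList : {A : Set} → List A → (A → ℚ) → ℚ
sumList xs f = foldr (λ x acc → f x + acc) 0ℚ xs

sumFin : (k : ℕ) → (Fin k → ℚ) → ℚ
sumFin k f = sumList (allFin k) f

edgeTerm : {n : ℕ} → Vector n → Fin n → Fin n → ℚ
edgeTerm f i j with i <? j
... | yes i<j = f ((i , j) , i<j)
... | no  _   = 0ℚ

sumEdges : (n : ℕ) → Vector n → ℚ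
sumEdges n f = sumFin n (λ i → sumFin n (λ j → edgeTerm f i j))

cutVec : {n : ℕ} → Subset n → Vector n
cutVec S ((i , j) , _) = if lookup S i xor lookup S j then 1ℚ else 0ℚ

⟨_,_⟩ : {n : ℕ} → Vector n → Vector n → ℚ
⟨_,_⟩ {n} c v = sumEdges n (λ e → c e * v e)

-- A cut: a nonempty proper subset of V (X and ∁ X give the same cut).
IsCut : {n : ℕ} → Subset n → Set
IsCut X = Nonempty X × Nonempty (∁ X)

DistinctCuts : {n : ℕ} → Subset n → Subset n → Set
DistinctCuts X Y = X ≢ Y × X ≢ ∁ Y

Crossing : {n : ℕ} → Subset n → Subset n → Set
Crossing A B =
  Nonempty (A ∩ B) × Nonempty (A ∩ ∁ B) × Nonempty (B ∩ ∁ A) × Nonempty (∁ (A ∪ B))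

InCone : {n : ℕ} → Subset n → Vector n → Set
InCone {n} X c =
  (∀ (e : Edge n) → 0ℚ ≤ c e) ×
  (∀ (Y : Subset n) → IsCut Y → ⟨ c , cutVec X ⟩ ≤ ⟨ c , cutVec Y ⟩)

LinIndep : {n k : ℕ} → (Fin k → Vector n) → Set
LinIndep {n} {k} u =
  ∀ (a : Fin k → ℚ) →
    (∀ (e : Edge n) → sumFin k (λ i → a i * u i e) ≡ 0ℚ) →
    ∀ (i : Fin k) → a i ≡ 0ℚ

-- dim C = m : the linear span of C has dimension m, i.e. C contains
-- m linearly independent vectors but not m+1.
HasDim : {n : ℕ} → (Vector n → Set) → ℕ → Set
HasDim {n} C m =
  (Σ[ u ∈ (Fin m → Vector n) ] ((∀ i → C (u i)) × LinIndep u)) ×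
  (¬ (Σ[ u ∈ (Fin (ℕ.suc m) → Vector n) ] ((∀ i → C (u i)) × LinIndep u)))

Adjacent : {n : ℕ} → Subset n → Subset n → Set
Adjacent {n} X Y = HasDim (λ c → InCone X c × InCone Y c) (dim-ambient n ℕ.∸ 1)

{-# OPTIONS --safe #-}
-- Every c in K⁺min(X) ∩ K⁺min(Y) satisfies ⟨c, v(X)⟩ = ⟨c, v(Y)⟩, and distinct cuts have
-- distinct cut vectors, so the intersection spans at most a hyperplane.
--
-- If X and Y cross, then X ∩ Y and X ∪ Y are cuts, and submodularity of the cut function,
-- v(X) + v(Y) = v(X ∩ Y) + v(X ∪ Y) + 2·[edges between X ∖ Y and Y ∖ X], forces every such c
-- to vanish on the edges between X ∖ Y and Y ∖ X.  The same argument for X and ∁ Y kills the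
-- edges between X ∩ Y and ∁ (X ∪ Y), so the intersection has dimension at most d − 2.
--
-- If they do not cross, complementing X or Y makes them disjoint, so that P = X, Q = Y and
-- R = ∁ (X ∪ Y) are three nonempty blocks with representatives p, q, r.  Putting weight 2 on the
-- edges inside the blocks, the only cuts that can be lighter than 2 are δ(P), δ(Q) and δ(R), and
-- the weights  2·[inside] + [pr] + [g] + (1 + v(P)_g − v(Q)_g)·[qr]  for g ≠ qr make δ(P) and
-- δ(Q) equally light and minimal.  On the coordinates g ≠ qr these d − 1 vectors form the matrix
-- I + 𝟏 Cᵀ with C ≥ 0, which is nonsingular.
module Submission where

open import Defs
open import Algebra.Bundles using (CommutativeRing)
open import Data.Bool as Bool using (Bool; true; false; not; _∧_; _∨_; _xor_; if_then_else_)
open import Data.Bool.Properties using (xor-comm; xor-same; ¬-not; not-involutive; ∨-comm; ∨-conical)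
open import Data.Empty using (⊥; ⊥-elim)
open import Data.Fin as Fin using (Fin; zero; suc; punchIn; _<?_)
import Data.Fin.Properties as FinP
open import Data.Fin.Subset using (Subset; ∁; _∩_; _∪_; Nonempty; _∈_; _∉_)
open import Data.Fin.Subset.Properties
  using (nonempty?; x∈p∩q⁺; x∈p∩q⁻; x∈p∪q⁺; x∈p∪q⁻; x∉p⇒x∈∁p; x∈∁p⇒x∉p)
open import Data.List as List using (List; []; _∷_; _++_; length; allFin; filter)
import Data.List.Properties as ListP
open import Data.List.Membership.Propositional using () renaming (_∈_ to _∈ᴸ_)
import Data.List.Membership.Propositional.Properties as ∈P
open import Data.List.Relation.Unary.All as All using (All; []; _∷_)
import Data.List.Relation.Unary.All.Properties as AllP
open import Data.List.Relation.Unary.Any using (here; there)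
open import Data.List.Relation.Unary.Unique.Propositional using (Unique; []; _∷_)
import Data.List.Relation.Unary.Unique.Propositional.Properties as UniqueP
open import Data.Nat as ℕ using (ℕ; zero; suc; z≤n; s≤s; _∸_)
import Data.Nat.Properties as ℕP
open import Data.Nat.Combinatorics using (_C_; nC1≡n; nCk+nC[k+1]≡[n+1]C[k+1])
open import Data.Product using (Σ-syntax; ∃; ∃₂; _×_; _,_; proj₁; proj₂)
open import Data.Product.Properties using (≡-dec)
open import Data.Rational as ℚ using (ℚ; 0ℚ; 1ℚ; _+_; _*_; -_; _-_; _≤_; 1/_)
import Data.Rational.Properties as ℚP
open import Data.Sum as Sum using (_⊎_; inj₁; inj₂)
open import Data.Vec as Vec using (Vec; lookup)
import Data.Vec.Properties as VecP
open import Data.Vec.Functional using (insertAt; removeAt)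
open import Data.Vec.Functional.Properties using (insertAt-lookup; insertAt-punchIn)
open import Function using (_∘_; id)
open import Function.Bundles using (_⇔_; mk⇔)
open import Relation.Binary using (tri<; tri≈; tri>)
open import Relation.Binary.Definitions using (DecidableEquality)
open import Relation.Binary.PropositionalEquality
open import Relation.Nullary using (¬_; Dec; yes; no; does; contradiction)
open import Relation.Nullary.Decidable using (¬?; dec⇒maybe)
open import Tactic.RingSolver using (solve-∀)
open import Tactic.RingSolver.Core.AlmostCommutativeRing using (AlmostCommutativeRing; fromCommutativeRing)
open import Algebra.Properties.CommutativeMonoid.Sum ℚP.+-0-commutativeMonoid
  using (sum; sum-syntax; sum-cong-≗; sum-replicate-zero; sum-remove; ∑-distrib-+)
open import Algebra.Properties.Semiring.Sum (CommutativeRing.semiring ℚP.+-*-commutativeRing)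
  using (*-distribˡ-sum; *-distribʳ-sum)

ℚ-ring : AlmostCommutativeRing _ _
ℚ-ring = fromCommutativeRing ℚP.+-*-commutativeRing (λ x → dec⇒maybe (0ℚ ℚ.≟ x))

p*q≡0⇒p≡0 : ∀ {p q} → q ≢ 0ℚ → p * q ≡ 0ℚ → p ≡ 0ℚ
p*q≡0⇒p≡0 {p} {q} q≢0 pq≡0 = begin
  p             ≡⟨ cancel p q ⟨
  p * q * 1/ q  ≡⟨ cong (_* 1/ q) pq≡0 ⟩
  0ℚ * 1/ q     ≡⟨ ℚP.*-zeroˡ (1/ q) ⟩
  0ℚ            ∎
  where
  open ≡-Reasoning
  instance _ = ℚ.≢-nonZero q≢0
  cancel : ∀ p q .{{_ : ℚ.NonZero q}} → p * q * 1/ q ≡ p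
  cancel p q = trans (ℚP.*-assoc p q (1/ q)) (trans (cong (p *_) (ℚP.*-inverseʳ q)) (ℚP.*-identityʳ p))

p*q≡p*r⇒p≡0 : ∀ {p q r} → q ≢ r → p * q ≡ p * r → p ≡ 0ℚ
p*q≡p*r⇒p≡0 {p} {q} {r} q≢r pq≡pr =
  p*q≡0⇒p≡0 q-r≢0 (trans (distrib p q r) (trans (cong (_- p * r) pq≡pr) (ℚP.+-inverseʳ (p * r))))
  where
  distrib : ∀ p q r → p * (q - r) ≡ p * q - p * r
  distrib = solve-∀ ℚ-ring
  recover : ∀ q r → q - r + r ≡ q
  recover = solve-∀ ℚ-ring
  q-r≢0 : q - r ≢ 0ℚ
  q-r≢0 q-r≡0 = q≢r (trans (sym (recover q r)) (trans (cong (_+ r) q-r≡0) (ℚP.+-identityˡ r)))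

*-nonneg : ∀ {p q} → 0ℚ ≤ p → 0ℚ ≤ q → 0ℚ ≤ p * q
*-nonneg {p} {q} 0≤p 0≤q =
  ℚP.nonNegative⁻¹ (p * q) {{ℚP.nonNeg*nonNeg⇒nonNeg p {{ℚ.nonNegative 0≤p}} q {{ℚ.nonNegative 0≤q}}}}

p≤p+q : ∀ p {q} → 0ℚ ≤ q → p ≤ p + q
p≤p+q p {q} 0≤q = subst (_≤ p + q) (ℚP.+-identityʳ p) (ℚP.+-monoʳ-≤ p 0≤q)

+-nonneg : ∀ {p q} → 0ℚ ≤ p → 0ℚ ≤ q → 0ℚ ≤ p + q
+-nonneg {p} 0≤p 0≤q = ℚP.≤-trans 0≤p (p≤p+q p 0≤q)

p+q≤p⇒q≤0 : ∀ p q → p + q ≤ p → q ≤ 0ℚ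
p+q≤p⇒q≤0 p q p+q≤p = subst₂ _≤_ (cancel p q) (ℚP.+-inverseˡ p) (ℚP.+-monoʳ-≤ (- p) p+q≤p)
  where
  cancel : ∀ p q → - p + (p + q) ≡ q
  cancel = solve-∀ ℚ-ring

indicator : Bool → ℚ
indicator b = if b then 1ℚ else 0ℚ

indicator-nonneg : ∀ b → 0ℚ ≤ indicator b
indicator-nonneg true  = ℚP.≤ᵇ⇒≤ _
indicator-nonneg false = ℚP.≤-refl

indicator≤1 : ∀ b → indicator b ≤ 1ℚ
indicator≤1 true  = ℚP.≤-refl
indicator≤1 false = ℚP.≤ᵇ⇒≤ _

1-indicator-nonneg : ∀ b → 0ℚ ≤ 1ℚ - indicator b
1-indicator-nonneg true  = ℚP.≤-refl
1-indicator-nonneg false = ℚP.≤ᵇ⇒≤ _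

indicator-injective : ∀ {a b} → indicator a ≡ indicator b → a ≡ b
indicator-injective {true}  {true}  _   = refl
indicator-injective {false} {false} _   = refl
indicator-injective {true}  {false} 1≡0 = contradiction 1≡0 ℚP.1≢0
indicator-injective {false} {true}  0≡1 = contradiction (sym 0≡1) ℚP.1≢0

sumList-tabulate : ∀ {A : Set} k (g : Fin k → A) (f : A → ℚ) →
  sumList (List.tabulate g) f ≡ ∑[ i < k ] f (g i)
sumList-tabulate zero    g f = refl
sumList-tabulate (suc k) g f = cong (f (g zero) +_) (sumList-tabulate k (g ∘ suc) f)

sumFin≡∑ : ∀ k (f : Fin k → ℚ) → sumFin k f ≡ ∑[ i < k ] f i
sumFin≡∑ k f = sumList-tabulate k id f

∑-zero : ∀ {k} {f : Fin k → ℚ} → (∀ i → f i ≡ 0ℚ) → ∑[ i < k ] f i ≡ 0ℚ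
∑-zero {k} f≡0 = trans (sum-cong-≗ f≡0) (sum-replicate-zero k)

∑-nonneg : ∀ {k} {f : Fin k → ℚ} → (∀ i → 0ℚ ≤ f i) → 0ℚ ≤ ∑[ i < k ] f i
∑-nonneg {zero}  f≥0 = ℚP.≤-refl
∑-nonneg {suc k} f≥0 = ℚP.+-mono-≤ (f≥0 zero) (∑-nonneg (f≥0 ∘ suc))

∑-δ : ∀ {k} {f : Fin (suc k) → ℚ} i → (∀ j → j ≢ i → f j ≡ 0ℚ) → ∑[ j < suc k ] f j ≡ f i
∑-δ {f = f} i f≡0 = begin
  sum f                     ≡⟨ sum-remove f ⟩
  f i + sum (removeAt f i)  ≡⟨ cong (f i +_) (∑-zero (λ j → f≡0 (punchIn i j) (FinP.punchInᵢ≢i i j))) ⟩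
  f i + 0ℚ                  ≡⟨ ℚP.+-identityʳ (f i) ⟩
  f i                       ∎
  where open ≡-Reasoning

term≤∑ : ∀ {k} {f : Fin (suc k) → ℚ} → (∀ j → 0ℚ ≤ f j) → ∀ i → f i ≤ ∑[ j < suc k ] f j
term≤∑ {f = f} f≥0 i = begin
  f i                       ≡⟨ ℚP.+-identityʳ (f i) ⟨
  f i + 0ℚ                  ≤⟨ ℚP.+-monoʳ-≤ (f i) (∑-nonneg (f≥0 ∘ punchIn i)) ⟩
  f i + sum (removeAt f i)  ≡⟨ sum-remove f ⟨
  sum f                     ∎
  where open ℚP.≤-Reasoning

-- Linear dependence

combination : {A : Set} {m : ℕ} → (Fin m → ℚ) → (Fin m → A → ℚ) → A → ℚ
combination {m = m} a u x = ∑[ i < m ] (a i * u i x)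

combination-vanishes : {A : Set} {m : ℕ} (a : Fin m → ℚ) (u : Fin m → A → ℚ) {x : A} →
  (∀ i → u i x ≡ 0ℚ) → combination a u x ≡ 0ℚ
combination-vanishes a u ux≡0 = ∑-zero (λ i → trans (cong (a i *_) (ux≡0 i)) (ℚP.*-zeroʳ (a i)))

record RelationOn {A : Set} {m : ℕ} (u : Fin m → A → ℚ) (L : List A) : Set where
  constructor relation
  field
    coeff      : Fin m → ℚ
    nontrivial : ∃ λ i → coeff i ≢ 0ℚ
    vanishes   : All (λ x → combination coeff u x ≡ 0ℚ) L

-- Eliminating the coordinate x with the pivot u j: the reduced vectors vanish at x, and every
-- relation among them lifts to a relation among the u.
module Pivot {A : Set} {m : ℕ} (u : Fin (suc m) → A → ℚ) (x : A) (j : Fin (suc m)) where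

  reduced : Fin m → A → ℚ
  reduced i y = u j x * u (punchIn j i) y - u (punchIn j i) x * u j y

  reduced-vanishes : ∀ i → reduced i x ≡ 0ℚ
  reduced-vanishes i = lemma (u j x) (u (punchIn j i) x)
    where
    lemma : ∀ a b → a * b - b * a ≡ 0ℚ
    lemma = solve-∀ ℚ-ring

  lift : (Fin m → ℚ) → Fin (suc m) → ℚ
  lift b = insertAt (λ i → u j x * b i) j (- combination b (u ∘ punchIn j) x)

  combination-lift : ∀ b y → combination (lift b) u y ≡ combination b reduced y
  combination-lift b y = begin
    combination (lift b) u y
      ≡⟨ sum-remove (λ k → lift b k * u k y) ⟩
    lift b j * u j y + ∑[ i < m ] (lift b (punchIn j i) * u (punchIn j i) y)
      ≡⟨ cong₂ _+_ (cong (_* u j y) (insertAt-lookup _ j _))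
                   (sum-cong-≗ (λ i → cong (_* u (punchIn j i) y) (insertAt-punchIn _ j _ i))) ⟩
    - P * u j y + ∑[ i < m ] (u j x * b i * u (punchIn j i) y)
      ≡⟨ swap P (u j y) _ ⟩
    ∑[ i < m ] (u j x * b i * u (punchIn j i) y) + P * - u j y
      ≡⟨ cong (∑[ i < m ] (u j x * b i * u (punchIn j i) y) +_)
              (*-distribʳ-sum (- u j y) (λ i → b i * u (punchIn j i) x)) ⟩
    ∑[ i < m ] (u j x * b i * u (punchIn j i) y) + ∑[ i < m ] (b i * u (punchIn j i) x * - u j y)
      ≡⟨ ∑-distrib-+ (λ i → u j x * b i * u (punchIn j i) y) (λ i → b i * u (punchIn j i) x * - u j y) ⟨
    ∑[ i < m ] (u j x * b i * u (punchIn j i) y + b i * u (punchIn j i) x * - u j y)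
      ≡⟨ sum-cong-≗ {m} (λ i → distribute (b i) (u j x) (u (punchIn j i) y) (u (punchIn j i) x) (u j y)) ⟩
    combination b reduced y ∎
    where
    open ≡-Reasoning
    P = combination b (u ∘ punchIn j) x
    swap : ∀ p t s → - p * t + s ≡ s + p * - t
    swap = solve-∀ ℚ-ring
    distribute : ∀ b c y z t → c * b * y + b * z * - t ≡ b * (c * y - z * t)
    distribute = solve-∀ ℚ-ring

length<⇒RelationOn : {A : Set} {m : ℕ} (u : Fin m → A → ℚ) (L : List A) →
  length L ℕ.< m → RelationOn u L
length<⇒RelationOn {m = suc m} u []      _          = relation (λ _ → 1ℚ) (zero , ℚP.1≢0) []
length<⇒RelationOn {m = suc m} u (x ∷ L) (s≤s |L|<m) with FinP.all? (λ j → u j x ℚ.≟ 0ℚ)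
... | yes ux≡0 = relation coeff nontrivial (combination-vanishes coeff u ux≡0 ∷ vanishes)
  where open RelationOn (length<⇒RelationOn u L (ℕP.m<n⇒m<1+n |L|<m))
... | no ¬ux≡0 =
  relation (lift coeff) (punchIn j i , lift-i≢0) (at-x ∷ All.map (trans (combination-lift coeff _)) vanishes)
  where
  pivot = FinP.¬∀⟶∃¬ _ _ (λ j → u j x ℚ.≟ 0ℚ) ¬ux≡0
  j = proj₁ pivot
  open Pivot u x j
  open RelationOn (length<⇒RelationOn reduced L |L|<m)
  i = proj₁ nontrivial
  lift-i≢0 : lift coeff (punchIn j i) ≢ 0ℚ
  lift-i≢0 eq = proj₂ nontrivial (p*q≡0⇒p≡0 (proj₂ pivot)
    (trans (ℚP.*-comm (coeff i) (u j x)) (trans (sym (insertAt-punchIn _ j _ i)) eq)))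
  at-x : combination (lift coeff) u x ≡ 0ℚ
  at-x = trans (combination-lift coeff x) (combination-vanishes coeff reduced reduced-vanishes)

∑*-identity+rank-one : ∀ {m} (C : Fin m → ℚ) (M : Fin m → Fin m → ℚ) →
  (∀ k → M k k ≡ C k + 1ℚ) → (∀ k l → k ≢ l → M k l ≡ C l) →
  ∀ (a : Fin m → ℚ) l → ∑[ k < m ] (a k * M k l) ≡ sum a * C l + a l
∑*-identity+rank-one {suc m} C M diagonal off-diagonal a l = begin
  ∑[ k < suc m ] (a k * M k l)
    ≡⟨ sum-cong-≗ (λ k → split (a k) (M k l) (C l)) ⟩
  ∑[ k < suc m ] (a k * C l + a k * (M k l - C l))
    ≡⟨ ∑-distrib-+ (λ k → a k * C l) (λ k → a k * (M k l - C l)) ⟩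
  ∑[ k < suc m ] (a k * C l) + ∑[ k < suc m ] (a k * (M k l - C l))
    ≡⟨ cong₂ _+_ (*-distribʳ-sum (C l) a) (sym (∑-δ {f = λ k → a k * (M k l - C l)} l excess-off)) ⟨
  sum a * C l + a l * (M l l - C l)
    ≡⟨ cong (λ x → sum a * C l + a l * (x - C l)) (diagonal l) ⟩
  sum a * C l + a l * (C l + 1ℚ - C l)
    ≡⟨ cong (sum a * C l +_) (unit (a l) (C l)) ⟩
  sum a * C l + a l ∎
  where
  open ≡-Reasoning
  split : ∀ a m c → a * m ≡ a * c + a * (m - c)
  split = solve-∀ ℚ-ring
  unit : ∀ a c → a * (c + 1ℚ - c) ≡ a
  unit = solve-∀ ℚ-ring
  excess-off : ∀ k → k ≢ l → a k * (M k l - C l) ≡ 0ℚ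
  excess-off k k≢l = trans (cong (λ x → a k * (x - C l)) (off-diagonal k l k≢l))
                           (trans (cong (a k *_) (ℚP.+-inverseʳ (C l))) (ℚP.*-zeroʳ (a k)))

identity+rank-one-nonsingular : ∀ {m} (C : Fin m → ℚ) → (∀ l → 0ℚ ≤ C l) →
  (a : Fin m → ℚ) → (∀ l → sum a * C l + a l ≡ 0ℚ) → ∀ l → a l ≡ 0ℚ
identity+rank-one-nonsingular {m} C C≥0 a eq l = begin
  a l         ≡⟨ a≡ l ⟩
  - S * C l   ≡⟨ cong (λ s → - s * C l) S≡0 ⟩
  - 0ℚ * C l  ≡⟨ ℚP.*-zeroˡ (C l) ⟩
  0ℚ          ∎
  where
  open ≡-Reasoning
  S = sum a
  a≡ : ∀ l → a l ≡ - S * C l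
  a≡ l = trans (rearrange S (C l) (a l)) (trans (cong (- S * C l +_) (eq l)) (ℚP.+-identityʳ (- S * C l)))
    where
    rearrange : ∀ s c y → y ≡ - s * c + (s * c + y)
    rearrange = solve-∀ ℚ-ring
  S*[1+∑C]≡0 : S * (1ℚ + sum C) ≡ 0ℚ
  S*[1+∑C]≡0 = begin
    S * (1ℚ + sum C)                   ≡⟨ expand S (sum C) ⟩
    S + S * sum C                      ≡⟨ cong (_+ S * sum C) (sum-cong-≗ a≡) ⟩
    sum (λ l → - S * C l) + S * sum C  ≡⟨ cong (_+ S * sum C) (*-distribˡ-sum (- S) C) ⟨
    - S * sum C + S * sum C            ≡⟨ cancel S (sum C) ⟩
    0ℚ                                 ∎
    where
    expand : ∀ s t → s * (1ℚ + t) ≡ s + s * t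
    expand = solve-∀ ℚ-ring
    cancel : ∀ s t → - s * t + s * t ≡ 0ℚ
    cancel = solve-∀ ℚ-ring
  1+∑C≢0 : 1ℚ + sum C ≢ 0ℚ
  1+∑C≢0 1+∑C≡0 =
    ℚP.<⇒≢ (ℚP.<-≤-trans (ℚP.positive⁻¹ 1ℚ) (p≤p+q 1ℚ (∑-nonneg C≥0))) (sym 1+∑C≡0)
  S≡0 : S ≡ 0ℚ
  S≡0 = p*q≡0⇒p≡0 1+∑C≢0 S*[1+∑C]≡0

xor-cancelʳ : ∀ a b c → (a xor c) xor (b xor c) ≡ a xor b
xor-cancelʳ true  true  true  = refl
xor-cancelʳ true  true  false = refl
xor-cancelʳ true  false true  = refl
xor-cancelʳ true  false false = refl
xor-cancelʳ false true  true  = refl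
xor-cancelʳ false true  false = refl
xor-cancelʳ false false true  = refl
xor-cancelʳ false false false = refl

xor≡false⇒≡ : ∀ {a b} → a xor b ≡ false → a ≡ b
xor≡false⇒≡ {true}  {true}  _ = refl
xor≡false⇒≡ {false} {false} _ = refl

xor-injectiveˡ : ∀ {a b} c → a xor c ≡ b xor c → a ≡ b
xor-injectiveˡ {a} {b} c eq =
  xor≡false⇒≡ (trans (sym (xor-cancelʳ a b c)) (trans (cong (_xor (b xor c)) eq) (xor-same (b xor c))))

≢⇒xor≡true : ∀ {a b} → a ≢ b → a xor b ≡ true
≢⇒xor≡true {true}  {true}  a≢b = contradiction refl a≢b
≢⇒xor≡true {true}  {false} _   = refl
≢⇒xor≡true {false} {true}  _   = refl
≢⇒xor≡true {false} {false} a≢b = contradiction refl a≢b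

xor-not-self : ∀ b → b xor not b ≡ true
xor-not-self true  = refl
xor-not-self false = refl

xor-not≡true⇒≡ : ∀ {a b} → a xor not b ≡ true → a ≡ b
xor-not≡true⇒≡ {true}  {true}  _ = refl
xor-not≡true⇒≡ {false} {false} _ = refl

complementary : ∀ {a b} → a ∨ b ≢ false → (a ≡ true → b ≡ false) → b ≡ a xor true
complementary {true}          _         a→¬b = a→¬b refl
complementary {false} {true}  _         _    = refl
complementary {false} {false} a∨b≢false _    = contradiction refl a∨b≢false

vec-ext : ∀ {A : Set} {n} {xs ys : Vec A n} → (∀ i → lookup xs i ≡ lookup ys i) → xs ≡ ys
vec-ext {xs = xs} {ys} xs≗ys =
  trans (sym (VecP.tabulate∘lookup xs)) (trans (VecP.tabulate-cong xs≗ys) (VecP.tabulate∘lookup ys))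

differ-at : ∀ {n} {xs ys : Vec Bool n} → xs ≢ ys → ∃ λ i → lookup xs i ≢ lookup ys i
differ-at {n} {xs} {ys} xs≢ys =
  FinP.¬∀⟶∃¬ n _ (λ i → lookup xs i Bool.≟ lookup ys i) (xs≢ys ∘ vec-ext)

lookup-∁ : ∀ {n} (S : Subset n) i → lookup (∁ S) i ≡ not (lookup S i)
lookup-∁ S i = VecP.lookup-map i not S

lookup-∪ : ∀ {n} (P Q : Subset n) i → lookup (P ∪ Q) i ≡ lookup P i ∨ lookup Q i
lookup-∪ P Q i = VecP.lookup-zipWith _∨_ i P Q

∈⇒lookup : ∀ {n} {S : Subset n} {i} → i ∈ S → lookup S i ≡ true
∈⇒lookup = VecP.[]=⇒lookup

∉⇒lookup : ∀ {n} {S : Subset n} {i} → i ∉ S → lookup S i ≡ false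
∉⇒lookup {S = S} {i} i∉S = ¬-not (i∉S ∘ VecP.lookup⇒[]= i S)

lookup⇒∈ : ∀ {n} {S : Subset n} {i} → lookup S i ≡ true → i ∈ S
lookup⇒∈ {S = S} {i} = VecP.lookup⇒[]= i S

lookup⇒∉ : ∀ {n} {S : Subset n} {i} → lookup S i ≡ false → i ∉ S
lookup⇒∉ Si≡false i∈S = contradiction (trans (sym (∈⇒lookup i∈S)) Si≡false) λ ()

edge-≡ : ∀ {n} {e e′ : Edge n} → proj₁ e ≡ proj₁ e′ → e ≡ e′
edge-≡ {e = ij , p} {e′ = .ij , p′} refl = cong (ij ,_) (FinP.<-irrelevant p p′)

_≟ᴱ_ : ∀ {n} → DecidableEquality (Edge n)
_≟ᴱ_ = ≡-dec (≡-dec FinP._≟_ FinP._≟_) (λ p p′ → yes (FinP.<-irrelevant p p′))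

onEdge : ∀ {n} {B : Set} → (Fin n → Fin n → B) → Edge n → B
onEdge F ((i , j) , _) = F i j

edge : ∀ {n} (i j : Fin n) → i ≢ j → Edge n
edge i j i≢j with FinP.<-cmp i j
... | tri< i<j _ _ = (i , j) , i<j
... | tri≈ _ i≡j _ = ⊥-elim (i≢j i≡j)
... | tri> _ _ j<i = (j , i) , j<i

onEdge-edge : ∀ {n} {B : Set} (F : Fin n → Fin n → B) → (∀ i j → F i j ≡ F j i) →
  ∀ i j (i≢j : i ≢ j) → onEdge F (edge i j i≢j) ≡ F i j
onEdge-edge F F-sym i j i≢j with FinP.<-cmp i j
... | tri< _ _ _   = refl
... | tri≈ _ i≡j _ = ⊥-elim (i≢j i≡j)
... | tri> _ _ _   = F-sym j i

𝟙 : ∀ {n} → Edge n → Vector n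
𝟙 e₀ e = indicator (does (e ≟ᴱ e₀))

𝟙-same : ∀ {n} (e : Edge n) → 𝟙 e e ≡ 1ℚ
𝟙-same e with e ≟ᴱ e
... | yes _  = refl
... | no e≢e = contradiction refl e≢e

𝟙-other : ∀ {n} {e₀ e : Edge n} → e ≢ e₀ → 𝟙 e₀ e ≡ 0ℚ
𝟙-other {e₀ = e₀} {e} e≢e₀ with e ≟ᴱ e₀
... | yes e≡e₀ = contradiction e≡e₀ e≢e₀
... | no _     = refl

private
  edgeFrom0 : ∀ {n} → Fin n → Edge (suc n)
  edgeFrom0 j = (zero , suc j) , s≤s z≤n

  liftEdge : ∀ {n} → Edge n → Edge (suc n)
  liftEdge ((i , j) , i<j) = (suc i , suc j) , s≤s i<j

allEdges : ∀ n → List (Edge n)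
allEdges zero    = []
allEdges (suc n) = List.map edgeFrom0 (allFin n) ++ List.map liftEdge (allEdges n)

length-allEdges : ∀ n → length (allEdges n) ≡ dim-ambient n
length-allEdges zero    = refl
length-allEdges (suc n) = begin
  length (List.map edgeFrom0 (allFin n) ++ List.map liftEdge (allEdges n))
    ≡⟨ ListP.length-++ (List.map edgeFrom0 (allFin n)) ⟩
  length (List.map edgeFrom0 (allFin n)) ℕ.+ length (List.map liftEdge (allEdges n))
    ≡⟨ cong₂ ℕ._+_ (trans (ListP.length-map edgeFrom0 (allFin n)) (ListP.length-tabulate id))
                   (trans (ListP.length-map liftEdge (allEdges n)) (length-allEdges n)) ⟩
  n ℕ.+ n C 2
    ≡⟨ cong (ℕ._+ n C 2) (nC1≡n n) ⟨
  n C 1 ℕ.+ n C 2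
    ≡⟨ nCk+nC[k+1]≡[n+1]C[k+1] n 1 ⟩
  suc n C 2 ∎
  where open ≡-Reasoning

∈-allEdges : ∀ {n} (e : Edge n) → e ∈ᴸ allEdges n
∈-allEdges {suc n} ((zero , suc j) , _) =
  ∈P.∈-++⁺ˡ (subst (_∈ᴸ List.map edgeFrom0 (allFin n)) (edge-≡ refl)
                   (∈P.∈-map⁺ edgeFrom0 (∈P.∈-allFin j)))
∈-allEdges {suc n} ((suc i , suc j) , s≤s i<j) =
  ∈P.∈-++⁺ʳ (List.map edgeFrom0 (allFin n)) (∈P.∈-map⁺ liftEdge (∈-allEdges ((i , j) , i<j)))

allEdges-unique : ∀ n → Unique (allEdges n)
allEdges-unique zero    = []
allEdges-unique (suc n) =
  UniqueP.++⁺ (UniqueP.map⁺ edgeFrom0-injective (UniqueP.allFin⁺ n))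
              (UniqueP.map⁺ liftEdge-injective (allEdges-unique n))
              (λ (e∈₀ , e∈₁) → disjoint (∈P.∈-map⁻ edgeFrom0 e∈₀) (∈P.∈-map⁻ liftEdge e∈₁))
  where
  edgeFrom0-injective : ∀ {i j : Fin n} → edgeFrom0 i ≡ edgeFrom0 j → i ≡ j
  edgeFrom0-injective refl = refl
  liftEdge-injective : ∀ {e e′ : Edge n} → liftEdge e ≡ liftEdge e′ → e ≡ e′
  liftEdge-injective {(_ , _) , _} {(_ , _) , _} refl = refl
  disjoint : ∀ {e} → ∃ (λ j → _ × e ≡ edgeFrom0 j) → ¬ ∃ (λ e′ → _ × e ≡ liftEdge e′)
  disjoint (_ , _ , refl) (_ , _ , ())

without : ∀ {n} → Edge n → List (Edge n) → List (Edge n)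
without e = filter (λ e′ → ¬? (e′ ≟ᴱ e))

length-without : ∀ {n} {e : Edge n} {xs} → Unique xs → e ∈ᴸ xs → suc (length (without e xs)) ≡ length xs
length-without {e = e} {_ ∷ xs} (e∉xs ∷ _) (here refl) = cong suc (cong length (begin
  without e (e ∷ xs)  ≡⟨ ListP.filter-reject (λ e′ → ¬? (e′ ≟ᴱ e)) (λ e≢e → e≢e refl) ⟩
  without e xs        ≡⟨ ListP.filter-all (λ e′ → ¬? (e′ ≟ᴱ e)) (All.map (_∘ sym) e∉xs) ⟩
  xs                  ∎))
  where open ≡-Reasoning
length-without {e = e} {x ∷ xs} (x∉xs ∷ xs-unique) (there e∈xs) = begin
  suc (length (without e (x ∷ xs)))
    ≡⟨ cong (suc ∘ length) (ListP.filter-accept (λ e′ → ¬? (e′ ≟ᴱ e)) (All.lookup x∉xs e∈xs)) ⟩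
  suc (suc (length (without e xs)))
    ≡⟨ cong suc (length-without xs-unique e∈xs) ⟩
  suc (length xs) ∎
  where open ≡-Reasoning

∈-without : ∀ {n} {e e′ : Edge n} {xs} → e′ ∈ᴸ xs → e′ ≢ e → e′ ∈ᴸ without e xs
∈-without {e = e} e′∈xs e′≢e = ∈P.∈-filter⁺ (λ e′ → ¬? (e′ ≟ᴱ e)) e′∈xs e′≢e

without-unique : ∀ {n} {e : Edge n} {xs} → Unique xs → Unique (without e xs)
without-unique {e = e} = UniqueP.filter⁺ (λ e′ → ¬? (e′ ≟ᴱ e))

length-allEdges-without : ∀ {n} (e : Edge n) → length (without e (allEdges n)) ≡ dim-ambient n ∸ 1
length-allEdges-without {n} e =
  cong (_∸ 1) (trans (length-without (allEdges-unique n) (∈-allEdges e)) (length-allEdges n))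

lookup-injective : ∀ {A : Set} {xs : List A} → Unique xs → ∀ {i j} →
  List.lookup xs i ≡ List.lookup xs j → i ≡ j
lookup-injective {xs = _ ∷ _} _          {zero}  {zero}  _  = refl
lookup-injective {xs = _ ∷ _} (x∉xs ∷ _) {zero}  {suc j} eq = contradiction eq (All.lookup x∉xs (∈P.∈-lookup j))
lookup-injective {xs = _ ∷ _} (x∉xs ∷ _) {suc i} {zero}  eq = contradiction (sym eq) (All.lookup x∉xs (∈P.∈-lookup i))
lookup-injective {xs = _ ∷ _} (_ ∷ xs-unique) {suc i} {suc j} eq = cong suc (lookup-injective xs-unique eq)

sumEdges≡∑∑ : ∀ n (f : Vector n) → sumEdges n f ≡ ∑[ i < n ] ∑[ j < n ] edgeTerm f i j
sumEdges≡∑∑ n f =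
  trans (sumFin≡∑ n (λ i → sumFin n (edgeTerm f i))) (sum-cong-≗ (λ i → sumFin≡∑ n (edgeTerm f i)))

edgeTerm-edge : ∀ {n} (f : Vector n) {i j} (i<j : i Fin.< j) → edgeTerm f i j ≡ f ((i , j) , i<j)
edgeTerm-edge f {i} {j} i<j with i <? j
... | yes _   = cong f (edge-≡ refl)
... | no i≮j = contradiction i<j i≮j

edgeTerm-zip : ∀ {n} (h : ℚ → ℚ → ℚ) → h 0ℚ 0ℚ ≡ 0ℚ → (f g : Vector n) → ∀ i j →
  edgeTerm (λ e → h (f e) (g e)) i j ≡ h (edgeTerm f i j) (edgeTerm g i j)
edgeTerm-zip h h00 f g i j with i <? j
... | yes _ = refl
... | no  _ = sym h00

edgeTerm-cong : ∀ {n} {f g : Vector n} → (∀ e → f e ≡ g e) → ∀ i j → edgeTerm f i j ≡ edgeTerm g i j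
edgeTerm-cong f≗g i j with i <? j
... | yes _ = f≗g _
... | no  _ = refl

edgeTerm-nonneg : ∀ {n} {f : Vector n} → (∀ e → 0ℚ ≤ f e) → ∀ i j → 0ℚ ≤ edgeTerm f i j
edgeTerm-nonneg f≥0 i j with i <? j
... | yes _ = f≥0 _
... | no  _ = ℚP.≤-refl

sumEdges-cong : ∀ {n} {f g : Vector n} → (∀ e → f e ≡ g e) → sumEdges n f ≡ sumEdges n g
sumEdges-cong {n} {f} {g} f≗g = begin
  sumEdges n f                                  ≡⟨ sumEdges≡∑∑ n f ⟩
  ∑[ i < n ] ∑[ j < n ] edgeTerm f i j          ≡⟨ sum-cong-≗ (λ i → sum-cong-≗ (edgeTerm-cong f≗g i)) ⟩
  ∑[ i < n ] ∑[ j < n ] edgeTerm g i j          ≡⟨ sumEdges≡∑∑ n g ⟨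
  sumEdges n g                                  ∎
  where open ≡-Reasoning

sumEdges-+ : ∀ {n} (f g : Vector n) → sumEdges n (λ e → f e + g e) ≡ sumEdges n f + sumEdges n g
sumEdges-+ {n} f g = begin
  sumEdges n (λ e → f e + g e)
    ≡⟨ sumEdges≡∑∑ n _ ⟩
  ∑[ i < n ] ∑[ j < n ] edgeTerm (λ e → f e + g e) i j
    ≡⟨ sum-cong-≗ (λ i → sum-cong-≗ (edgeTerm-zip _+_ refl f g i)) ⟩
  ∑[ i < n ] ∑[ j < n ] (edgeTerm f i j + edgeTerm g i j)
    ≡⟨ sum-cong-≗ (λ i → ∑-distrib-+ (edgeTerm f i) (edgeTerm g i)) ⟩
  ∑[ i < n ] (∑[ j < n ] edgeTerm f i j + ∑[ j < n ] edgeTerm g i j)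
    ≡⟨ ∑-distrib-+ (λ i → ∑[ j < n ] edgeTerm f i j) (λ i → ∑[ j < n ] edgeTerm g i j) ⟩
  ∑[ i < n ] ∑[ j < n ] edgeTerm f i j + ∑[ i < n ] ∑[ j < n ] edgeTerm g i j
    ≡⟨ cong₂ _+_ (sumEdges≡∑∑ n f) (sumEdges≡∑∑ n g) ⟨
  sumEdges n f + sumEdges n g ∎
  where open ≡-Reasoning

sumEdges-scale : ∀ {n} k (f : Vector n) → sumEdges n (λ e → k * f e) ≡ k * sumEdges n f
sumEdges-scale {n} k f = begin
  sumEdges n (λ e → k * f e)
    ≡⟨ sumEdges≡∑∑ n _ ⟩
  ∑[ i < n ] ∑[ j < n ] edgeTerm (λ e → k * f e) i j
    ≡⟨ sum-cong-≗ (λ i → sum-cong-≗ (edgeTerm-zip (λ a _ → k * a) (ℚP.*-zeroʳ k) f f i)) ⟩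
  ∑[ i < n ] ∑[ j < n ] (k * edgeTerm f i j)
    ≡⟨ sum-cong-≗ (λ i → *-distribˡ-sum k (edgeTerm f i)) ⟨
  ∑[ i < n ] (k * ∑[ j < n ] edgeTerm f i j)
    ≡⟨ *-distribˡ-sum k (λ i → ∑[ j < n ] edgeTerm f i j) ⟨
  k * ∑[ i < n ] ∑[ j < n ] edgeTerm f i j
    ≡⟨ cong (k *_) (sumEdges≡∑∑ n f) ⟨
  k * sumEdges n f ∎
  where open ≡-Reasoning

sumEdges-zero : ∀ {n} {f : Vector n} → (∀ e → f e ≡ 0ℚ) → sumEdges n f ≡ 0ℚ
sumEdges-zero {n} {f} f≡0 = trans (sumEdges≡∑∑ n f) (∑-zero (λ i → ∑-zero (λ j → edgeTerm≡0 i j)))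
  where
  edgeTerm≡0 : ∀ i j → edgeTerm f i j ≡ 0ℚ
  edgeTerm≡0 i j with i <? j
  ... | yes _ = f≡0 _
  ... | no  _ = refl

sumEdges-∑ : ∀ {n m} (f : Fin m → Vector n) →
  sumEdges n (λ e → ∑[ k < m ] f k e) ≡ ∑[ k < m ] sumEdges n (f k)
sumEdges-∑ {n} {m = zero}  f = sumEdges-zero {n} (λ _ → refl)
sumEdges-∑ {m = suc m} f =
  trans (sumEdges-+ (f zero) (λ e → ∑[ k < m ] f (suc k) e))
        (cong (sumEdges _ (f zero) +_) (sumEdges-∑ (f ∘ suc)))

sumEdges-δ : ∀ {n} (f : Vector n) (e₀ : Edge n) → (∀ e → e ≢ e₀ → f e ≡ 0ℚ) → sumEdges n f ≡ f e₀
sumEdges-δ {suc n} f e₀@((a , b) , a<b) f≡0 = begin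
  sumEdges (suc n) f                            ≡⟨ sumEdges≡∑∑ (suc n) f ⟩
  ∑[ i < suc n ] ∑[ j < suc n ] edgeTerm f i j
    ≡⟨ ∑-δ a (λ i i≢a → ∑-zero (λ j → off {i} {j} (i≢a ∘ cong proj₁))) ⟩
  ∑[ j < suc n ] edgeTerm f a j                 ≡⟨ ∑-δ b (λ j j≢b → off {a} {j} (j≢b ∘ cong proj₂)) ⟩
  edgeTerm f a b                                ≡⟨ edgeTerm-edge f a<b ⟩
  f e₀                                          ∎
  where
  open ≡-Reasoning
  off : ∀ {i j} → (i , j) ≢ (a , b) → edgeTerm f i j ≡ 0ℚ
  off {i} {j} ij≢ab with i <? j
  ... | yes _ = f≡0 _ (ij≢ab ∘ cong proj₁)
  ... | no  _ = refl

term≤sumEdges : ∀ {n} {f : Vector n} → (∀ e → 0ℚ ≤ f e) → ∀ e → f e ≤ sumEdges n f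
term≤sumEdges {suc n} {f} f≥0 e@((a , b) , a<b) = begin
  f e                                           ≡⟨ edgeTerm-edge f a<b ⟨
  edgeTerm f a b                                ≤⟨ term≤∑ (edgeTerm-nonneg f≥0 a) b ⟩
  ∑[ j < suc n ] edgeTerm f a j                 ≤⟨ term≤∑ (λ i → ∑-nonneg (edgeTerm-nonneg f≥0 i)) a ⟩
  ∑[ i < suc n ] ∑[ j < suc n ] edgeTerm f i j  ≡⟨ sumEdges≡∑∑ (suc n) f ⟨
  sumEdges (suc n) f                            ∎
  where open ℚP.≤-Reasoning

⟨⟩-congʳ : ∀ {n} (c : Vector n) {v w : Vector n} → (∀ e → v e ≡ w e) → ⟨ c , v ⟩ ≡ ⟨ c , w ⟩
⟨⟩-congʳ c v≗w = sumEdges-cong (λ e → cong (c e *_) (v≗w e))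

⟨⟩-+ˡ : ∀ {n} (c c′ w : Vector n) → ⟨ (λ e → c e + c′ e) , w ⟩ ≡ ⟨ c , w ⟩ + ⟨ c′ , w ⟩
⟨⟩-+ˡ c c′ w = trans (sumEdges-cong (λ e → ℚP.*-distribʳ-+ (w e) (c e) (c′ e)))
  (sumEdges-+ (λ e → c e * w e) (λ e → c′ e * w e))

⟨⟩-+ʳ : ∀ {n} (c v w : Vector n) → ⟨ c , (λ e → v e + w e) ⟩ ≡ ⟨ c , v ⟩ + ⟨ c , w ⟩
⟨⟩-+ʳ c v w = trans (sumEdges-cong (λ e → ℚP.*-distribˡ-+ (c e) (v e) (w e)))
  (sumEdges-+ (λ e → c e * v e) (λ e → c e * w e))

⟨⟩-scaleˡ : ∀ {n} k (c w : Vector n) → ⟨ (λ e → k * c e) , w ⟩ ≡ k * ⟨ c , w ⟩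
⟨⟩-scaleˡ k c w = trans (sumEdges-cong (λ e → ℚP.*-assoc k (c e) (w e))) (sumEdges-scale k (λ e → c e * w e))

⟨⟩-δ : ∀ {n} {c : Vector n} (w : Vector n) {e₀ : Edge n} → (∀ e → e ≢ e₀ → c e ≡ 0ℚ) →
  ⟨ c , w ⟩ ≡ c e₀ * w e₀
⟨⟩-δ {c = c} w {e₀} c≡0 =
  sumEdges-δ _ e₀ (λ e e≢e₀ → trans (cong (_* w e) (c≡0 e e≢e₀)) (ℚP.*-zeroˡ (w e)))

⟨𝟙⟩ : ∀ {n} (e₀ : Edge n) (w : Vector n) → ⟨ 𝟙 e₀ , w ⟩ ≡ w e₀
⟨𝟙⟩ e₀ w = begin
  ⟨ 𝟙 e₀ , w ⟩  ≡⟨ ⟨⟩-δ w (λ e e≢e₀ → 𝟙-other e≢e₀) ⟩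
  𝟙 e₀ e₀ * w e₀ ≡⟨ cong (_* w e₀) (𝟙-same e₀) ⟩
  1ℚ * w e₀     ≡⟨ ℚP.*-identityˡ (w e₀) ⟩
  w e₀          ∎
  where open ≡-Reasoning

⟨combination⟩ : ∀ {n m} (a : Fin m → ℚ) (u : Fin m → Vector n) (w : Vector n) →
  ⟨ combination a u , w ⟩ ≡ ∑[ k < m ] (a k * ⟨ u k , w ⟩)
⟨combination⟩ {m = m} a u w = begin
  ⟨ combination a u , w ⟩
    ≡⟨ sumEdges-cong (λ e → *-distribʳ-sum (w e) (λ k → a k * u k e)) ⟩
  sumEdges _ (λ e → ∑[ k < m ] (a k * u k e * w e))
    ≡⟨ sumEdges-∑ (λ k e → a k * u k e * w e) ⟩
  ∑[ k < m ] sumEdges _ (λ e → a k * u k e * w e)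
    ≡⟨ sum-cong-≗ (λ k → ⟨⟩-scaleˡ (a k) (u k) w) ⟩
  ∑[ k < m ] (a k * ⟨ u k , w ⟩) ∎
  where open ≡-Reasoning

⟨⟩-nonneg-term : ∀ {n} {c w : Vector n} → (∀ e → 0ℚ ≤ c e) → (∀ e → 0ℚ ≤ w e) →
  ∀ e → c e * w e ≤ ⟨ c , w ⟩
⟨⟩-nonneg-term c≥0 w≥0 = term≤sumEdges (λ e → *-nonneg (c≥0 e) (w≥0 e))

-- Cut vectors and cones

crosses : ∀ {n} → Subset n → Edge n → Bool
crosses S = onEdge (λ i j → lookup S i xor lookup S j)

cutVec-nonneg : ∀ {n} (S : Subset n) e → 0ℚ ≤ cutVec S e
cutVec-nonneg S e = indicator-nonneg (crosses S e)

cutVec-edge : ∀ {n} (S : Subset n) i j (i≢j : i ≢ j) →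
  cutVec S (edge i j i≢j) ≡ indicator (lookup S i xor lookup S j)
cutVec-edge S i j i≢j = cong indicator (onEdge-edge _ (λ a b → xor-comm (lookup S a) (lookup S b)) i j i≢j)

cutVec-xor : ∀ {n} {Z S : Subset n} b → (∀ i → lookup Z i ≡ lookup S i xor b) →
  ∀ e → cutVec Z e ≡ cutVec S e
cutVec-xor {S = S} b Z≡S⊕b ((i , j) , _) =
  cong indicator (trans (cong₂ _xor_ (Z≡S⊕b i) (Z≡S⊕b j)) (xor-cancelʳ (lookup S i) (lookup S j) b))

cutVec-∁ : ∀ {n} (S : Subset n) e → cutVec (∁ S) e ≡ cutVec S e
cutVec-∁ S = cutVec-xor {Z = ∁ S} {S} true (λ i → trans (lookup-∁ S i) (xor-comm true (lookup S i)))

distinct⇒cutVec-differs : ∀ {n} {X Y : Subset n} → DistinctCuts X Y → ∃ λ e → cutVec X e ≢ cutVec Y e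
distinct⇒cutVec-differs {X = X} {Y} (X≢Y , X≢∁Y) = edge i j i≢j , differs
  where
  i = proj₁ (differ-at X≢Y)
  Xi≢Yi = proj₂ (differ-at X≢Y)
  j = proj₁ (differ-at X≢∁Y)
  Xj≡Yj : lookup X j ≡ lookup Y j
  Xj≡Yj = trans (¬-not (λ eq → proj₂ (differ-at X≢∁Y) (trans eq (sym (lookup-∁ Y j)))))
                (not-involutive (lookup Y j))
  i≢j : i ≢ j
  i≢j i≡j = Xi≢Yi (subst (λ k → lookup X k ≡ lookup Y k) (sym i≡j) Xj≡Yj)
  differs : cutVec X (edge i j i≢j) ≢ cutVec Y (edge i j i≢j)
  differs eq = Xi≢Yi (xor-injectiveˡ (lookup X j) (trans
    (indicator-injective (trans (sym (cutVec-edge X i j i≢j)) (trans eq (cutVec-edge Y i j i≢j))))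
    (cong (lookup Y i xor_) (sym Xj≡Yj))))

cut-attains : ∀ {n} {S : Subset n} → IsCut S → ∀ b → ∃ λ i → lookup S i ≡ b
cut-attains ((i , i∈S) , _)  true  = i , ∈⇒lookup i∈S
cut-attains (_ , (i , i∈∁S)) false = i , ∉⇒lookup (x∈∁p⇒x∉p i∈∁S)

InCone-cong : ∀ {n} {X X′ : Subset n} {c : Vector n} → (∀ e → cutVec X e ≡ cutVec X′ e) →
  InCone X c → InCone X′ c
InCone-cong {c = c} X≗X′ (c≥0 , minimal) =
  c≥0 , λ Y Y-cut → subst (_≤ _) (⟨⟩-congʳ c X≗X′) (minimal Y Y-cut)

InCone-∁ : ∀ {n} {X : Subset n} {c : Vector n} → InCone X c → InCone (∁ X) c
InCone-∁ {X = X} = InCone-cong {X = X} {∁ X} (λ e → sym (cutVec-∁ X e))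

cones-pair-equally : ∀ {n} {X Y : Subset n} {c : Vector n} → IsCut X → IsCut Y →
  InCone X c → InCone Y c → ⟨ c , cutVec X ⟩ ≡ ⟨ c , cutVec Y ⟩
cones-pair-equally X-cut Y-cut (_ , X-min) (_ , Y-min) = ℚP.≤-antisym (X-min _ Y-cut) (Y-min _ X-cut)

-- Bounds on the dimension

IndependentFamily : ∀ {n} → (Vector n → Set) → ℕ → Set
IndependentFamily {n} K m = Σ[ u ∈ (Fin m → Vector n) ] ((∀ i → K (u i)) × LinIndep u)

IndependentFamily-mono : ∀ {n} {K K′ : Vector n → Set} {m} → (∀ {c} → K c → K′ c) →
  IndependentFamily K m → IndependentFamily K′ m
IndependentFamily-mono K⊆K′ (u , u∈K , independent) = u , K⊆K′ ∘ u∈K , independent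

determined-by-short-list⇒¬LinIndep : ∀ {n m} (u : Fin m → Vector n) (L : List (Edge n)) → length L ℕ.< m →
  (∀ a → All (λ e → combination a u e ≡ 0ℚ) L → ∀ e → combination a u e ≡ 0ℚ) → ¬ LinIndep u
determined-by-short-list⇒¬LinIndep {m = m} u L |L|<m determined independent =
  proj₂ nontrivial
    (independent coeff (λ e → trans (sumFin≡∑ m _) (determined coeff vanishes e)) (proj₁ nontrivial))
  where open RelationOn (length<⇒RelationOn u L |L|<m)

pairs-equally⇒¬LinIndep : ∀ {n} (u : Fin (suc (dim-ambient n ∸ 1)) → Vector n) {v w : Vector n}
  (e₀ : Edge n) → v e₀ ≢ w e₀ → (∀ k → ⟨ u k , v ⟩ ≡ ⟨ u k , w ⟩) → ¬ LinIndep u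
pairs-equally⇒¬LinIndep {n} u {v} {w} e₀ v≢w equal = determined-by-short-list⇒¬LinIndep u L
  (s≤s (ℕP.≤-reflexive (length-allEdges-without e₀))) determined
  where
  L = without e₀ (allEdges n)
  off-e₀ : ∀ a → All (λ e → combination a u e ≡ 0ℚ) L → ∀ e → e ≢ e₀ → combination a u e ≡ 0ℚ
  off-e₀ a vanishes e e≢e₀ = All.lookup vanishes (∈-without (∈-allEdges e) e≢e₀)
  determined : ∀ a → All (λ e → combination a u e ≡ 0ℚ) L → ∀ e → combination a u e ≡ 0ℚ
  determined a vanishes e with e ≟ᴱ e₀
  ... | no e≢e₀  = off-e₀ a vanishes e e≢e₀
  ... | yes refl = p*q≡p*r⇒p≡0 v≢w (begin
    combination a u e₀ * v e₀        ≡⟨ ⟨⟩-δ v (off-e₀ a vanishes) ⟨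
    ⟨ combination a u , v ⟩          ≡⟨ ⟨combination⟩ a u v ⟩
    ∑[ k < _ ] (a k * ⟨ u k , v ⟩)  ≡⟨ sum-cong-≗ (λ k → cong (a k *_) (equal k)) ⟩
    ∑[ k < _ ] (a k * ⟨ u k , w ⟩)  ≡⟨ ⟨combination⟩ a u w ⟨
    ⟨ combination a u , w ⟩          ≡⟨ ⟨⟩-δ w (off-e₀ a vanishes) ⟩
    combination a u e₀ * w e₀        ∎)
    where open ≡-Reasoning

vanish-on-two-edges⇒¬LinIndep : ∀ {n} (u : Fin (dim-ambient n ∸ 1) → Vector n) {e₁ e₂ : Edge n} → e₁ ≢ e₂ →
  (∀ k → u k e₁ ≡ 0ℚ × u k e₂ ≡ 0ℚ) → ¬ LinIndep u
vanish-on-two-edges⇒¬LinIndep {n} u {e₁} {e₂} e₁≢e₂ vanish =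
  determined-by-short-list⇒¬LinIndep u L short determined
  where
  L = without e₂ (without e₁ (allEdges n))
  short : length L ℕ.< dim-ambient n ∸ 1
  short = ℕP.≤-reflexive (trans
    (length-without (without-unique (allEdges-unique n)) (∈-without (∈-allEdges e₂) (e₁≢e₂ ∘ sym)))
    (length-allEdges-without e₁))
  determined : ∀ a → All (λ e → combination a u e ≡ 0ℚ) L → ∀ e → combination a u e ≡ 0ℚ
  determined a vanishes e with e ≟ᴱ e₁ | e ≟ᴱ e₂
  ... | yes refl | _        = combination-vanishes a u (proj₁ ∘ vanish)
  ... | no _     | yes refl = combination-vanishes a u (proj₂ ∘ vanish)
  ... | no e≢e₁  | no e≢e₂  = All.lookup vanishes (∈-without (∈-without (∈-allEdges e) e≢e₁) e≢e₂)

-- Crossing cuts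

differenceEdgeᵇ : Bool → Bool → Bool → Bool → Bool
differenceEdgeᵇ x y x′ y′ = (x ∧ not y ∧ y′ ∧ not x′) ∨ (x′ ∧ not y′ ∧ y ∧ not x)

submodular-bits : ∀ x y x′ y′ →
  indicator (x xor x′) + indicator (y xor y′) ≡
  indicator ((x ∧ y) xor (x′ ∧ y′)) + indicator ((x ∨ y) xor (x′ ∨ y′))
    + (indicator (differenceEdgeᵇ x y x′ y′) + indicator (differenceEdgeᵇ x y x′ y′))
submodular-bits true  true  true  true  = refl
submodular-bits true  true  true  false = refl
submodular-bits true  true  false true  = refl
submodular-bits true  true  false false = refl
submodular-bits true  false true  true  = refl
submodular-bits true  false true  false = refl
submodular-bits true  false false true  = refl
submodular-bits true  false false false = refl
submodular-bits false true  true  true  = refl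
submodular-bits false true  true  false = refl
submodular-bits false true  false true  = refl
submodular-bits false true  false false = refl
submodular-bits false false true  true  = refl
submodular-bits false false true  false = refl
submodular-bits false false false true  = refl
submodular-bits false false false false = refl

differenceEdges : ∀ {n} → Subset n → Subset n → Vector n
differenceEdges X Y =
  indicator ∘ onEdge (λ i j → differenceEdgeᵇ (lookup X i) (lookup Y i) (lookup X j) (lookup Y j))

differenceEdges-edge : ∀ {n} (X Y : Subset n) i j (i≢j : i ≢ j) {x y x′ y′} →
  lookup X i ≡ x → lookup Y i ≡ y → lookup X j ≡ x′ → lookup Y j ≡ y′ →
  differenceEdges X Y (edge i j i≢j) ≡ indicator (differenceEdgeᵇ x y x′ y′)
differenceEdges-edge X Y i j i≢j refl refl refl refl = cong indicator (onEdge-edge F F-sym i j i≢j)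
  where
  F : Fin _ → Fin _ → Bool
  F a b = differenceEdgeᵇ (lookup X a) (lookup Y a) (lookup X b) (lookup Y b)
  F-sym : ∀ a b → F a b ≡ F b a
  F-sym a b = ∨-comm (lookup X a ∧ not (lookup Y a) ∧ lookup Y b ∧ not (lookup X b)) _

cutVec-submodular : ∀ {n} (X Y : Subset n) e →
  cutVec X e + cutVec Y e ≡ cutVec (X ∩ Y) e + cutVec (X ∪ Y) e + (differenceEdges X Y e + differenceEdges X Y e)
cutVec-submodular X Y ((i , j) , _)
  rewrite VecP.lookup-zipWith _∧_ i X Y | VecP.lookup-zipWith _∧_ j X Y
        | VecP.lookup-zipWith _∨_ i X Y | VecP.lookup-zipWith _∨_ j X Y
  = submodular-bits (lookup X i) (lookup Y i) (lookup X j) (lookup Y j)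

-- ⟨c, v(X)⟩ + ⟨c, v(Y)⟩ exceeds ⟨c, v(X ∩ Y)⟩ + ⟨c, v(X ∪ Y)⟩ by 2 ⟨c, differenceEdges X Y⟩, and
-- minimality of X and Y makes this excess ≤ 0.
cones-vanish-on-differenceEdges : ∀ {n} {X Y : Subset n} {c : Vector n} → InCone X c → InCone Y c →
  IsCut (X ∩ Y) → IsCut (X ∪ Y) → ∀ e → differenceEdges X Y e ≡ 1ℚ → c e ≡ 0ℚ
cones-vanish-on-differenceEdges {X = X} {Y} {c} (c≥0 , X-min) (_ , Y-min) ∩-cut ∪-cut e D≡1 =
  ℚP.≤-antisym ce≤0 (c≥0 e)
  where
  open ℚP.≤-Reasoning
  D = differenceEdges X Y
  s = ⟨ c , D ⟩
  K = ⟨ c , cutVec (X ∩ Y) ⟩ + ⟨ c , cutVec (X ∪ Y) ⟩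
  ce≤s : c e ≤ s
  ce≤s = begin
    c e         ≡⟨ trans (sym (ℚP.*-identityʳ (c e))) (cong (c e *_) (sym D≡1)) ⟩
    c e * D e   ≤⟨ ⟨⟩-nonneg-term c≥0 (indicator-nonneg ∘ _) e ⟩
    s           ∎
  pairings : ⟨ c , cutVec X ⟩ + ⟨ c , cutVec Y ⟩ ≡ K + (s + s)
  pairings = begin-equality
    ⟨ c , cutVec X ⟩ + ⟨ c , cutVec Y ⟩
      ≡⟨ ⟨⟩-+ʳ c (cutVec X) (cutVec Y) ⟨
    ⟨ c , (λ e → cutVec X e + cutVec Y e) ⟩
      ≡⟨ ⟨⟩-congʳ c (cutVec-submodular X Y) ⟩
    ⟨ c , (λ e → cutVec (X ∩ Y) e + cutVec (X ∪ Y) e + (D e + D e)) ⟩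
      ≡⟨ ⟨⟩-+ʳ c (λ e → cutVec (X ∩ Y) e + cutVec (X ∪ Y) e) (λ e → D e + D e) ⟩
    ⟨ c , (λ e → cutVec (X ∩ Y) e + cutVec (X ∪ Y) e) ⟩ + ⟨ c , (λ e → D e + D e) ⟩
      ≡⟨ cong₂ _+_ (⟨⟩-+ʳ c (cutVec (X ∩ Y)) (cutVec (X ∪ Y))) (⟨⟩-+ʳ c D D) ⟩
    K + (s + s) ∎
  ce≤0 : c e ≤ 0ℚ
  ce≤0 = begin
    c e    ≤⟨ ce≤s ⟩
    s      ≤⟨ p≤p+q s (ℚP.≤-trans (c≥0 e) ce≤s) ⟩
    s + s  ≤⟨ p+q≤p⇒q≤0 K (s + s) (subst (_≤ K) pairings (ℚP.+-mono-≤ (X-min _ ∩-cut) (Y-min _ ∪-cut))) ⟩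
    0ℚ     ∎

crossing⇒cones-vanish-on-two-edges : ∀ {n} {X Y : Subset n} → Crossing X Y →
  ∃₂ λ e₁ e₂ → e₁ ≢ e₂ × (∀ {c} → InCone X c → InCone Y c → c e₁ ≡ 0ℚ × c e₂ ≡ 0ℚ)
crossing⇒cones-vanish-on-two-edges {X = X} {Y} ((a , a∈X∩Y) , (b , b∈X∖Y) , (c , c∈Y∖X) , (d , d∉X∪Y)) =
  edge b c b≢c , edge a d a≢d , e₁≢e₂ ,
  λ X-cone Y-cone → cones-vanish-on-differenceEdges {X = X} {Y} X-cone Y-cone ∩-cut ∪-cut _ D₁
                  , cones-vanish-on-differenceEdges {X = X} {∁ Y} X-cone (InCone-∁ {X = Y} Y-cone)
                                                    ∩∁-cut ∪∁-cut _ D₂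
  where
  a∈X = proj₁ (x∈p∩q⁻ X Y a∈X∩Y)
  a∈Y = proj₂ (x∈p∩q⁻ X Y a∈X∩Y)
  b∈X = proj₁ (x∈p∩q⁻ X (∁ Y) b∈X∖Y)
  b∉Y = x∈∁p⇒x∉p (proj₂ (x∈p∩q⁻ X (∁ Y) b∈X∖Y))
  c∈Y = proj₁ (x∈p∩q⁻ Y (∁ X) c∈Y∖X)
  c∉X = x∈∁p⇒x∉p (proj₂ (x∈p∩q⁻ Y (∁ X) c∈Y∖X))
  d∉X = x∈∁p⇒x∉p d∉X∪Y ∘ x∈p∪q⁺ ∘ inj₁
  d∉Y = x∈∁p⇒x∉p d∉X∪Y ∘ x∈p∪q⁺ ∘ inj₂
  b≢c : b ≢ c
  b≢c refl = c∉X b∈X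
  a≢d : a ≢ d
  a≢d refl = d∉X a∈X
  ∩-cut : IsCut (X ∩ Y)
  ∩-cut = (a , a∈X∩Y) , (d , x∉p⇒x∈∁p (d∉X ∘ proj₁ ∘ x∈p∩q⁻ X Y))
  ∪-cut : IsCut (X ∪ Y)
  ∪-cut = (a , x∈p∪q⁺ (inj₁ a∈X)) , (d , d∉X∪Y)
  ∩∁-cut : IsCut (X ∩ ∁ Y)
  ∩∁-cut = (b , b∈X∖Y)
         , (a , x∉p⇒x∈∁p (λ a∈X∖Y → x∈∁p⇒x∉p (proj₂ (x∈p∩q⁻ X (∁ Y) a∈X∖Y)) a∈Y))
  ∪∁-cut : IsCut (X ∪ ∁ Y)
  ∪∁-cut = (a , x∈p∪q⁺ (inj₁ a∈X))
         , (c , x∉p⇒x∈∁p (Sum.[ c∉X , (λ c∈∁Y → x∈∁p⇒x∉p c∈∁Y c∈Y) ] ∘ x∈p∪q⁻ X (∁ Y)))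
  D₁ : differenceEdges X Y (edge b c b≢c) ≡ 1ℚ
  D₁ = differenceEdges-edge X Y b c b≢c (∈⇒lookup b∈X) (∉⇒lookup b∉Y) (∉⇒lookup c∉X) (∈⇒lookup c∈Y)
  D₂ : differenceEdges X (∁ Y) (edge a d a≢d) ≡ 1ℚ
  D₂ = differenceEdges-edge X (∁ Y) a d a≢d (∈⇒lookup a∈X) ∁Ya (∉⇒lookup d∉X) ∁Yd
    where
    ∁Ya : lookup (∁ Y) a ≡ false
    ∁Ya = trans (lookup-∁ Y a) (cong not (∈⇒lookup a∈Y))
    ∁Yd : lookup (∁ Y) d ≡ true
    ∁Yd = trans (lookup-∁ Y d) (cong not (∉⇒lookup d∉Y))
  D₀ : differenceEdges X Y (edge a d a≢d) ≡ 0ℚ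
  D₀ = differenceEdges-edge X Y a d a≢d (∈⇒lookup a∈X) (∈⇒lookup a∈Y) (∉⇒lookup d∉X) (∉⇒lookup d∉Y)
  e₁≢e₂ : edge b c b≢c ≢ edge a d a≢d
  e₁≢e₂ e₁≡e₂ = ℚP.1≢0 (trans (sym D₁) (trans (cong (differenceEdges X Y) e₁≡e₂) D₀))

crossing⇒¬Adjacent : ∀ {n} {X Y : Subset n} → Crossing X Y → ¬ Adjacent X Y
crossing⇒¬Adjacent crossing ((u , u∈cones , independent) , _) =
  vanish-on-two-edges⇒¬LinIndep u e₁≢e₂
    (λ k → vanish {u k} (proj₁ (u∈cones k)) (proj₂ (u∈cones k))) independent
  where
  e₁≢e₂ = proj₁ (proj₂ (proj₂ (crossing⇒cones-vanish-on-two-edges crossing)))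
  vanish = proj₂ (proj₂ (proj₂ (crossing⇒cones-vanish-on-two-edges crossing)))

-- Non-crossing cuts

noncrossing⇒empty-quadrant : ∀ {n} {X Y : Subset n} → ¬ Crossing X Y →
  ∃₂ λ x₀ y₀ → ∀ {i} → lookup X i ≡ x₀ → lookup Y i ≡ y₀ → ⊥
noncrossing⇒empty-quadrant {X = X} {Y} ¬crossing
  with nonempty? (X ∩ Y) | nonempty? (X ∩ ∁ Y) | nonempty? (Y ∩ ∁ X) | nonempty? (∁ (X ∪ Y))
... | no empty | _ | _ | _ =
  true , true , λ Xi Yi → empty (_ , x∈p∩q⁺ (lookup⇒∈ Xi , lookup⇒∈ Yi))
... | yes _ | no empty | _ | _ =
  true , false , λ Xi Yi → empty (_ , x∈p∩q⁺ (lookup⇒∈ Xi , x∉p⇒x∈∁p (lookup⇒∉ Yi)))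
... | yes _ | yes _ | no empty | _ =
  false , true , λ Xi Yi → empty (_ , x∈p∩q⁺ (lookup⇒∈ Yi , x∉p⇒x∈∁p (lookup⇒∉ Xi)))
... | yes _ | yes _ | yes _ | no empty =
  false , false , λ Xi Yi → empty (_ , x∉p⇒x∈∁p (Sum.[ lookup⇒∉ Xi , lookup⇒∉ Yi ] ∘ x∈p∪q⁻ X Y))
... | yes ∩ | yes ∩∁ | yes ∁∩ | yes ∁∪ = ⊥-elim (¬crossing (∩ , ∩∁ , ∁∩ , ∁∪))

shift : ∀ {n} → Subset n → Bool → Subset n
shift S b = Vec.map (_xor b) S

lookup-shift : ∀ {n} (S : Subset n) b i → lookup (shift S b) i ≡ lookup S i xor b
lookup-shift S b i = VecP.lookup-map i (_xor b) S

cutVec-shift : ∀ {n} (S : Subset n) b e → cutVec (shift S b) e ≡ cutVec S e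
cutVec-shift S b = cutVec-xor {Z = shift S b} {S} b (lookup-shift S b)

shift-not≡true⇒≡ : ∀ {n} (S : Subset n) {b i} → lookup (shift S (not b)) i ≡ true → lookup S i ≡ b
shift-not≡true⇒≡ S {b} {i} eq = xor-not≡true⇒≡ (trans (sym (lookup-shift S (not b) i)) eq)

≡⇒shift-not≡true : ∀ {n} (S : Subset n) {b i} → lookup S i ≡ b → lookup (shift S (not b)) i ≡ true
≡⇒shift-not≡true S {b} {i} refl = trans (lookup-shift S (not b) i) (xor-not-self b)

module ThreeBlocks {n : ℕ} (P Q : Subset n) (disjoint : ∀ {i} → lookup P i ≡ true → lookup Q i ≡ false)
  {p q r : Fin n} (p∈P : lookup P p ≡ true) (q∈Q : lookup Q q ≡ true)
  (r∉P : lookup P r ≡ false) (r∉Q : lookup Q r ≡ false) where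

  p∉Q : lookup Q p ≡ false
  p∉Q = disjoint p∈P

  q∉P : lookup P q ≡ false
  q∉P = ¬-not (λ q∈P → contradiction (trans (sym q∈Q) (disjoint q∈P)) λ ())

  p≢r : p ≢ r
  p≢r refl = contradiction (trans (sym p∈P) r∉P) λ ()

  q≢r : q ≢ r
  q≢r refl = contradiction (trans (sym q∈Q) r∉Q) λ ()

  pr qr : Edge n
  pr = edge p r p≢r
  qr = edge q r q≢r

  rep : Fin n → Fin n
  rep i = if lookup P i then p else if lookup Q i then q else r

  rep-block : ∀ i → lookup P (rep i) ≡ lookup P i × lookup Q (rep i) ≡ lookup Q i
  rep-block i with lookup P i in Pi | lookup Q i in Qi
  ... | true  | _     = p∈P , trans p∉Q (trans (sym (disjoint Pi)) Qi)
  ... | false | true  = q∉P , q∈Q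
  ... | false | false = r∉P , r∉Q

  rep-cases : ∀ i → rep i ≡ p ⊎ rep i ≡ q ⊎ rep i ≡ r
  rep-cases i with lookup P i | lookup Q i
  ... | true  | _     = inj₁ refl
  ... | false | true  = inj₂ (inj₁ refl)
  ... | false | false = inj₂ (inj₂ refl)

  Unsplit : Subset n → Set
  Unsplit Z = ∀ i → lookup Z i ≡ lookup Z (rep i)

  unsplit? : ∀ Z → Dec (Unsplit Z)
  unsplit? Z = FinP.all? (λ i → lookup Z i Bool.≟ lookup Z (rep i))

  P-unsplit : Unsplit P
  P-unsplit i = sym (proj₁ (rep-block i))

  Q-unsplit : Unsplit Q
  Q-unsplit i = sym (proj₂ (rep-block i))

  P∪Q-unsplit : Unsplit (P ∪ Q)
  P∪Q-unsplit i =
    trans (lookup-∪ P Q i) (trans (cong₂ _∨_ (P-unsplit i) (Q-unsplit i)) (sym (lookup-∪ P Q (rep i))))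

  ∁-unsplit : ∀ {Z} → Unsplit Z → Unsplit (∁ Z)
  ∁-unsplit {Z} Z-unsplit i = trans (lookup-∁ Z i) (trans (cong not (Z-unsplit i)) (sym (lookup-∁ Z (rep i))))

  unsplit-agree : ∀ {Z S} → Unsplit Z → Unsplit S → lookup Z p ≡ lookup S p → lookup Z q ≡ lookup S q →
    lookup Z r ≡ lookup S r → Z ≡ S
  unsplit-agree {Z} {S} Z-unsplit S-unsplit Zp≡Sp Zq≡Sq Zr≡Sr = vec-ext (λ i →
    trans (Z-unsplit i) (trans (at-rep (rep-cases i)) (sym (S-unsplit i))))
    where
    at-rep : ∀ {j} → j ≡ p ⊎ j ≡ q ⊎ j ≡ r → lookup Z j ≡ lookup S j
    at-rep (inj₁ refl)        = Zp≡Sp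
    at-rep (inj₂ (inj₁ refl)) = Zq≡Sq
    at-rep (inj₂ (inj₂ refl)) = Zr≡Sr

  unsplit-shape : ∀ Z → Nonempty Z → Unsplit Z → lookup Z r ≡ false → Z ≡ P ⊎ Z ≡ Q ⊎ Z ≡ P ∪ Q
  unsplit-shape Z (i , i∈Z) Z-unsplit Zr≡false with lookup Z p in Zp | lookup Z q in Zq
  ... | true  | false = inj₁ (unsplit-agree Z-unsplit P-unsplit
        (trans Zp (sym p∈P)) (trans Zq (sym q∉P)) (trans Zr≡false (sym r∉P)))
  ... | false | true  = inj₂ (inj₁ (unsplit-agree Z-unsplit Q-unsplit
        (trans Zp (sym p∉Q)) (trans Zq (sym q∈Q)) (trans Zr≡false (sym r∉Q))))
  ... | true  | true  = inj₂ (inj₂ (unsplit-agree Z-unsplit P∪Q-unsplit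
        (trans Zp (sym (trans (lookup-∪ P Q p) (cong (_∨ lookup Q p) p∈P))))
        (trans Zq (sym (trans (lookup-∪ P Q q) (cong₂ _∨_ q∉P q∈Q))))
        (trans Zr≡false (sym (trans (lookup-∪ P Q r) (cong₂ _∨_ r∉P r∉Q))))))
  ... | false | false =
    contradiction (trans (sym (∈⇒lookup i∈Z)) (trans (Z-unsplit i) (at-rep (rep-cases i)))) λ ()
    where
    at-rep : ∀ {j} → j ≡ p ⊎ j ≡ q ⊎ j ≡ r → lookup Z j ≡ false
    at-rep (inj₁ refl)        = Zp
    at-rep (inj₂ (inj₁ refl)) = Zq
    at-rep (inj₂ (inj₂ refl)) = Zr≡false

  -- edges with both ends in the same block
  inside : Vector n
  inside = indicator ∘ onEdge (λ i j → not ((lookup P i xor lookup P j) ∨ (lookup Q i xor lookup Q j)))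

  inside-nonneg : ∀ e → 0ℚ ≤ inside e
  inside-nonneg e = indicator-nonneg _

  ⟨inside,unsplit⟩ : ∀ {Z} → Unsplit Z → ⟨ inside , cutVec Z ⟩ ≡ 0ℚ
  ⟨inside,unsplit⟩ {Z} Z-unsplit = sumEdges-zero term≡0
    where
    term≡0 : ∀ e → inside e * cutVec Z e ≡ 0ℚ
    term≡0 e@((i , j) , _) with (lookup P i xor lookup P j) ∨ (lookup Q i xor lookup Q j) in crossed
    ... | true  = ℚP.*-zeroˡ (cutVec Z e)
    ... | false = cong (λ b → 1ℚ * indicator b) Zi≡Zj
      where
      Pi≡Pj : lookup P i ≡ lookup P j
      Pi≡Pj = xor≡false⇒≡ (proj₁ ∨-conical (lookup P i xor lookup P j) (lookup Q i xor lookup Q j) crossed)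
      Qi≡Qj : lookup Q i ≡ lookup Q j
      Qi≡Qj = xor≡false⇒≡ (proj₂ ∨-conical (lookup P i xor lookup P j) (lookup Q i xor lookup Q j) crossed)
      same-rep : rep i ≡ rep j
      same-rep = cong₂ (λ a b → if a then p else if b then q else r) Pi≡Pj Qi≡Qj
      Zi≡Zj : lookup Z i xor lookup Z j ≡ false
      Zi≡Zj = trans (cong₂ _xor_ (Z-unsplit i) (trans (Z-unsplit j) (cong (lookup Z) (sym same-rep))))
                    (xor-same (lookup Z (rep i)))

  inside-edge-rep : ∀ i (i≢rep : i ≢ rep i) → inside (edge i (rep i) i≢rep) ≡ 1ℚ
  inside-edge-rep i i≢rep = cong indicator (trans (onEdge-edge F F-sym i (rep i) i≢rep) same-block)
    where
    F : Fin n → Fin n → Bool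
    F a b = not ((lookup P a xor lookup P b) ∨ (lookup Q a xor lookup Q b))
    F-sym : ∀ a b → F a b ≡ F b a
    F-sym a b = cong not (cong₂ _∨_ (xor-comm (lookup P a) (lookup P b)) (xor-comm (lookup Q a) (lookup Q b)))
    same-block : F i (rep i) ≡ true
    same-block = cong not (cong₂ _∨_
      (trans (cong (lookup P i xor_) (proj₁ (rep-block i))) (xor-same (lookup P i)))
      (trans (cong (lookup Q i xor_) (proj₂ (rep-block i))) (xor-same (lookup Q i))))

  two : ℚ
  two = 1ℚ + 1ℚ

  tilt : Edge n → ℚ
  tilt g = 1ℚ + cutVec P g - cutVec Q g

  base : Vector n
  base e = two * inside e + 𝟙 pr e

  weight : Edge n → Vector n
  weight g e = base e + 𝟙 g e + tilt g * 𝟙 qr e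

  weight-pairing : ∀ g w → ⟨ weight g , w ⟩ ≡ two * ⟨ inside , w ⟩ + w pr + w g + tilt g * w qr
  weight-pairing g w = begin
    ⟨ weight g , w ⟩
      ≡⟨ ⟨⟩-+ˡ (λ e → base e + 𝟙 g e) (λ e → tilt g * 𝟙 qr e) w ⟩
    ⟨ (λ e → base e + 𝟙 g e) , w ⟩ + ⟨ (λ e → tilt g * 𝟙 qr e) , w ⟩
      ≡⟨ cong₂ _+_ (⟨⟩-+ˡ base (𝟙 g) w) (⟨⟩-scaleˡ (tilt g) (𝟙 qr) w) ⟩
    ⟨ base , w ⟩ + ⟨ 𝟙 g , w ⟩ + tilt g * ⟨ 𝟙 qr , w ⟩
      ≡⟨ cong₂ _+_ (cong₂ _+_ ⟨base⟩ (⟨𝟙⟩ g w)) (cong (tilt g *_) (⟨𝟙⟩ qr w)) ⟩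
    two * ⟨ inside , w ⟩ + w pr + w g + tilt g * w qr ∎
    where
    open ≡-Reasoning
    ⟨base⟩ : ⟨ base , w ⟩ ≡ two * ⟨ inside , w ⟩ + w pr
    ⟨base⟩ = trans (⟨⟩-+ˡ (λ e → two * inside e) (𝟙 pr) w) (cong₂ _+_ (⟨⟩-scaleˡ two inside w) (⟨𝟙⟩ pr w))

  tilt-nonneg : ∀ g → 0ℚ ≤ tilt g
  tilt-nonneg g = subst (0ℚ ≤_) (reorder (cutVec P g) (cutVec Q g))
    (+-nonneg (1-indicator-nonneg (crosses Q g)) (cutVec-nonneg P g))
    where
    reorder : ∀ x y → 1ℚ - y + x ≡ 1ℚ + x - y
    reorder = solve-∀ ℚ-ring

  two-nonneg : 0ℚ ≤ two
  two-nonneg = ℚP.≤ᵇ⇒≤ _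

  base-nonneg : ∀ e → 0ℚ ≤ base e
  base-nonneg e = +-nonneg (*-nonneg two-nonneg (inside-nonneg e)) (indicator-nonneg _)

  two*inside≤weight : ∀ g e → two * inside e ≤ weight g e
  two*inside≤weight g e =
    ℚP.≤-trans (p≤p+q _ (indicator-nonneg _)) (ℚP.≤-trans (p≤p+q _ (indicator-nonneg _))
      (p≤p+q _ (*-nonneg (tilt-nonneg g) (indicator-nonneg _))))

  weight-nonneg : ∀ g e → 0ℚ ≤ weight g e
  weight-nonneg g e = ℚP.≤-trans (*-nonneg two-nonneg (inside-nonneg e)) (two*inside≤weight g e)

  cutVec-at : ∀ (S : Subset n) {i j} (i≢j : i ≢ j) {a b} → lookup S i ≡ a → lookup S j ≡ b →
    cutVec S (edge i j i≢j) ≡ indicator (a xor b)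
  cutVec-at S {i} {j} i≢j Si≡a Sj≡b = trans (cutVec-edge S i j i≢j) (cong indicator (cong₂ _xor_ Si≡a Sj≡b))

  level : Edge n → ℚ
  level g = 1ℚ + cutVec P g

  pairing-unsplit : ∀ g {S} → Unsplit S →
    ⟨ weight g , cutVec S ⟩ ≡ cutVec S pr + cutVec S g + tilt g * cutVec S qr
  pairing-unsplit g {S} S-unsplit = trans (weight-pairing g (cutVec S))
    (trans (cong (λ t → two * t + cutVec S pr + cutVec S g + tilt g * cutVec S qr) (⟨inside,unsplit⟩ {S} S-unsplit))
           (drop two (cutVec S pr) (cutVec S g) (tilt g * cutVec S qr)))
    where
    drop : ∀ h a b c → h * 0ℚ + a + b + c ≡ a + b + c
    drop = solve-∀ ℚ-ring

  pairing-P : ∀ g → ⟨ weight g , cutVec P ⟩ ≡ level g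
  pairing-P g = trans (pairing-unsplit g {P} P-unsplit)
    (trans (cong₂ (λ a b → a + cutVec P g + tilt g * b) (cutVec-at P p≢r p∈P r∉P) (cutVec-at P q≢r q∉P r∉P))
           (simplify (cutVec P g) (tilt g)))
    where
    simplify : ∀ x t → 1ℚ + x + t * 0ℚ ≡ 1ℚ + x
    simplify = solve-∀ ℚ-ring

  pairing-Q : ∀ g → ⟨ weight g , cutVec Q ⟩ ≡ level g
  pairing-Q g = trans (pairing-unsplit g {Q} Q-unsplit)
    (trans (cong₂ (λ a b → a + cutVec Q g + tilt g * b) (cutVec-at Q p≢r p∉Q r∉Q) (cutVec-at Q q≢r q∈Q r∉Q))
           (simplify (cutVec P g) (cutVec Q g)))
    where
    simplify : ∀ x y → 0ℚ + y + (1ℚ + x - y) * 1ℚ ≡ 1ℚ + x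
    simplify = solve-∀ ℚ-ring

  level≤pairing-P∪Q : ∀ g → level g ≤ ⟨ weight g , cutVec (P ∪ Q) ⟩
  level≤pairing-P∪Q g = begin
    1ℚ + x
      ≤⟨ p≤p+q (1ℚ + x) (+-nonneg (cutVec-nonneg (P ∪ Q) g) (1-indicator-nonneg (crosses Q g))) ⟩
    1ℚ + x + (z + (1ℚ - y))
      ≡⟨ reorder x y z ⟩
    1ℚ + z + (1ℚ + x - y) * 1ℚ
      ≡⟨ cong₂ (λ a b → a + z + tilt g * b) (cutVec-at (P ∪ Q) p≢r P∪Q-p P∪Q-r)
                                            (cutVec-at (P ∪ Q) q≢r P∪Q-q P∪Q-r) ⟨
    cutVec (P ∪ Q) pr + z + tilt g * cutVec (P ∪ Q) qr
      ≡⟨ pairing-unsplit g {P ∪ Q} P∪Q-unsplit ⟨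
    ⟨ weight g , cutVec (P ∪ Q) ⟩ ∎
    where
    open ℚP.≤-Reasoning
    x = cutVec P g
    y = cutVec Q g
    z = cutVec (P ∪ Q) g
    reorder : ∀ x y z → 1ℚ + x + (z + (1ℚ - y)) ≡ 1ℚ + z + (1ℚ + x - y) * 1ℚ
    reorder = solve-∀ ℚ-ring
    P∪Q-p : lookup (P ∪ Q) p ≡ true
    P∪Q-p = trans (lookup-∪ P Q p) (cong (_∨ lookup Q p) p∈P)
    P∪Q-q : lookup (P ∪ Q) q ≡ true
    P∪Q-q = trans (lookup-∪ P Q q) (cong₂ _∨_ q∉P q∈Q)
    P∪Q-r : lookup (P ∪ Q) r ≡ false
    P∪Q-r = trans (lookup-∪ P Q r) (cong₂ _∨_ r∉P r∉Q)

  level≤split : ∀ g {Z} → ¬ Unsplit Z → level g ≤ ⟨ weight g , cutVec Z ⟩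
  level≤split g {Z} split = begin
    1ℚ + cutVec P g          ≤⟨ ℚP.+-monoʳ-≤ 1ℚ (indicator≤1 (crosses P g)) ⟩
    two                      ≡⟨ trans (sym (ℚP.*-identityʳ two)) (cong (two *_) (sym (inside-edge-rep i i≢rep))) ⟩
    two * inside e           ≤⟨ two*inside≤weight g e ⟩
    weight g e               ≡⟨ trans (sym (ℚP.*-identityʳ (weight g e))) (cong (weight g e *_) (sym Ze≡1)) ⟩
    weight g e * cutVec Z e  ≤⟨ ⟨⟩-nonneg-term (weight-nonneg g) (cutVec-nonneg Z) e ⟩
    ⟨ weight g , cutVec Z ⟩  ∎
    where
    open ℚP.≤-Reasoning
    witness = FinP.¬∀⟶∃¬ n _ (λ i → lookup Z i Bool.≟ lookup Z (rep i)) split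
    i = proj₁ witness
    i≢rep : i ≢ rep i
    i≢rep i≡rep = proj₂ witness (cong (lookup Z) i≡rep)
    e = edge i (rep i) i≢rep
    Ze≡1 : cutVec Z e ≡ 1ℚ
    Ze≡1 = trans (cutVec-edge Z i (rep i) i≢rep) (cong indicator (≢⇒xor≡true (proj₂ witness)))

  level≤unsplit : ∀ g {Z} → Nonempty Z → Unsplit Z → lookup Z r ≡ false →
    level g ≤ ⟨ weight g , cutVec Z ⟩
  level≤unsplit g {Z} Z-nonempty Z-unsplit Zr≡false with unsplit-shape Z Z-nonempty Z-unsplit Zr≡false
  ... | inj₁ refl        = ℚP.≤-reflexive (sym (pairing-P g))
  ... | inj₂ (inj₁ refl) = ℚP.≤-reflexive (sym (pairing-Q g))
  ... | inj₂ (inj₂ refl) = level≤pairing-P∪Q g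

  level≤cut : ∀ g {Z} → IsCut Z → level g ≤ ⟨ weight g , cutVec Z ⟩
  level≤cut g {Z} (Z-nonempty , ∁Z-nonempty) with unsplit? Z | lookup Z r in Zr
  ... | no split      | _     = level≤split g {Z} split
  ... | yes Z-unsplit | false = level≤unsplit g Z-nonempty Z-unsplit Zr
  ... | yes Z-unsplit | true  = subst (level g ≤_) (⟨⟩-congʳ (weight g) (cutVec-∁ Z))
        (level≤unsplit g ∁Z-nonempty (∁-unsplit {Z} Z-unsplit) (trans (lookup-∁ Z r) (cong not Zr)))

  weight∈cones : ∀ g → InCone P (weight g) × InCone Q (weight g)
  weight∈cones g =
      (weight-nonneg g , λ Z Z-cut → subst (_≤ ⟨ weight g , cutVec Z ⟩) (sym (pairing-P g)) (level≤cut g Z-cut))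
    , (weight-nonneg g , λ Z Z-cut → subst (_≤ ⟨ weight g , cutVec Z ⟩) (sym (pairing-Q g)) (level≤cut g Z-cut))

  weight-off-qr : ∀ g e → e ≢ qr → weight g e ≡ base e + 𝟙 g e
  weight-off-qr g e e≢qr = begin
    base e + 𝟙 g e + tilt g * 𝟙 qr e  ≡⟨ cong (λ t → base e + 𝟙 g e + tilt g * t) (𝟙-other e≢qr) ⟩
    base e + 𝟙 g e + tilt g * 0ℚ      ≡⟨ cong (base e + 𝟙 g e +_) (ℚP.*-zeroʳ (tilt g)) ⟩
    base e + 𝟙 g e + 0ℚ               ≡⟨ ℚP.+-identityʳ (base e + 𝟙 g e) ⟩
    base e + 𝟙 g e                    ∎
    where open ≡-Reasoning

  -- On the coordinates g l ≠ qr the weights form the matrix 𝟏 baseᵀ + I.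
  independent-family : (R : List (Edge n)) → Unique R → All (_≢ qr) R →
    IndependentFamily (λ c → InCone P c × InCone Q c) (length R)
  independent-family R R-unique R∌qr = weight ∘ g , weight∈cones ∘ g , independent
    where
    g = List.lookup R
    g≢qr : ∀ l → g l ≢ qr
    g≢qr l = All.lookup R∌qr (∈P.∈-lookup l)
    diagonal : ∀ k → weight (g k) (g k) ≡ base (g k) + 1ℚ
    diagonal k = trans (weight-off-qr (g k) (g k) (g≢qr k)) (cong (base (g k) +_) (𝟙-same (g k)))
    off-diagonal : ∀ k l → k ≢ l → weight (g k) (g l) ≡ base (g l)
    off-diagonal k l k≢l = trans (weight-off-qr (g k) (g l) (g≢qr l))
      (trans (cong (base (g l) +_) (𝟙-other (k≢l ∘ sym ∘ lookup-injective R-unique)))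
             (ℚP.+-identityʳ (base (g l))))
    independent : LinIndep (weight ∘ g)
    independent a vanish = identity+rank-one-nonsingular (base ∘ g) (base-nonneg ∘ g) a (λ l →
      trans (sym (∑*-identity+rank-one (base ∘ g) (λ k l → weight (g k) (g l)) diagonal off-diagonal a l))
            (trans (sym (sumFin≡∑ _ (λ k → a k * weight (g k) (g l)))) (vanish (g l))))

  lower-bound : IndependentFamily (λ c → InCone P c × InCone Q c) (dim-ambient n ∸ 1)
  lower-bound = subst (IndependentFamily (λ c → InCone P c × InCone Q c)) (length-allEdges-without qr)
    (independent-family (without qr (allEdges n)) (without-unique (allEdges-unique n))
                        (AllP.all-filter (λ e → ¬? (e ≟ᴱ qr)) (allEdges n)))

disjoint⇒outside-vertex : ∀ {n} {P Q : Subset n} → (∀ {i} → lookup P i ≡ true → lookup Q i ≡ false) →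
  (∃ λ e → cutVec P e ≢ cutVec Q e) → ∃ λ r → lookup P r ≡ false × lookup Q r ≡ false
disjoint⇒outside-vertex {P = P} {Q} disjoint (e , Pe≢Qe)
  with FinP.any? (λ i → (lookup P i ∨ lookup Q i) Bool.≟ false)
... | yes (r , P∨Q≡false) = r , proj₁ ∨-conical _ _ P∨Q≡false , proj₂ ∨-conical _ _ P∨Q≡false
... | no none = contradiction
  (sym (cutVec-xor {Z = Q} {P} true (λ i → complementary (λ eq → none (i , eq)) disjoint) e)) Pe≢Qe

distinct⇒¬IndependentFamily : ∀ {n} {X Y : Subset n} → IsCut X → IsCut Y → DistinctCuts X Y →
  ¬ IndependentFamily (λ c → InCone X c × InCone Y c) (suc (dim-ambient n ∸ 1))
distinct⇒¬IndependentFamily X-cut Y-cut distinct (u , u∈cones , independent) =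
  pairs-equally⇒¬LinIndep u (proj₁ differ) (proj₂ differ)
    (λ k → cones-pair-equally X-cut Y-cut (proj₁ (u∈cones k)) (proj₂ (u∈cones k))) independent
  where differ = distinct⇒cutVec-differs distinct

noncrossing⇒Adjacent : ∀ {n} {X Y : Subset n} → IsCut X → IsCut Y → DistinctCuts X Y →
  ¬ Crossing X Y → Adjacent X Y
noncrossing⇒Adjacent {X = X} {Y} X-cut Y-cut distinct ¬crossing =
  IndependentFamily-mono {K = λ c → InCone P c × InCone Q c} {λ c → InCone X c × InCone Y c}
    (λ (P-cone , Q-cone) → InCone-cong {X = P} {X} P≗X P-cone , InCone-cong {X = Q} {Y} Q≗Y Q-cone) lower-bound ,
  distinct⇒¬IndependentFamily X-cut Y-cut distinct
  where
  x₀ = proj₁ (noncrossing⇒empty-quadrant ¬crossing)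
  y₀ = proj₁ (proj₂ (noncrossing⇒empty-quadrant ¬crossing))
  empty = proj₂ (proj₂ (noncrossing⇒empty-quadrant ¬crossing))
  P = shift X (not x₀)
  Q = shift Y (not y₀)
  P≗X : ∀ e → cutVec P e ≡ cutVec X e
  P≗X = cutVec-shift X (not x₀)
  Q≗Y : ∀ e → cutVec Q e ≡ cutVec Y e
  Q≗Y = cutVec-shift Y (not y₀)
  disjoint : ∀ {i} → lookup P i ≡ true → lookup Q i ≡ false
  disjoint Pi = ¬-not (λ Qi → empty (shift-not≡true⇒≡ X Pi) (shift-not≡true⇒≡ Y Qi))
  P≢Q : ∃ λ e → cutVec P e ≢ cutVec Q e
  P≢Q = let (e , X≢Y) = distinct⇒cutVec-differs distinct
        in e , λ P≡Q → X≢Y (trans (sym (P≗X e)) (trans P≡Q (Q≗Y e)))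
  outside : ∃ λ r → lookup P r ≡ false × lookup Q r ≡ false
  outside = disjoint⇒outside-vertex {P = P} {Q} disjoint P≢Q
  open ThreeBlocks P Q disjoint (≡⇒shift-not≡true X (proj₂ (cut-attains X-cut x₀)))
                                (≡⇒shift-not≡true Y (proj₂ (cut-attains Y-cut y₀)))
                                (proj₁ (proj₂ outside)) (proj₂ (proj₂ outside))

-- The hypothesis 2 ≤ n is implied by the existence of two distinct cuts.
theorem2 : (n : ℕ) → 2 ℕ.≤ n → (X Y : Subset n) → IsCut X → IsCut Y →
    DistinctCuts X Y → (Adjacent X Y ⇔ (¬ Crossing X Y))
theorem2 n _ X Y X-cut Y-cut distinct =
  mk⇔ (λ adjacent crossing → crossing⇒¬Adjacent crossing adjacent) (noncrossing⇒Adjacent X-cut Y-cut distinct)
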